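{- Let $n \geq 3$, let $P_n^1$ and $P_n^2$ be two disjoint copies of the path graph $P_n$ on $n$ vertices, and let $2P_n = P_n^1 \oplus P_n^2$. Then $$\Gamma_3(2P_n) \cong \Gamma_3(P_n) \oplus \Gamma_3(P_n) \oplus (\Gamma_2(P_n) \square P_n) \oplus (\Gamma_2(P_n) \square P_n).$$
   Context: All graphs are finite, simple and undirected. For a graph $G$ and a natural number $k$, the $k$-token graph $\Gamma_k(G)$ has as vertex set the collection of all $k$-element subsets of $V(G)$, and two distinct $k$-subsets $A,B$ are adjacent if and only if their symmetric difference $A \triangle B = \{x,y\}$ with $xy \in E(G)$. $G \oplus H$ denotes the disjoint union of graphs $G$ and $H$, and $G \square H$ denotes the Cartesian product: vertex set $V(G)\times V(H)$, with $(g,h)$ adjacent to $(g',h')$ iff either $g=g'$ and $hh' \in E(H)$, or $h=h'$ and $gg'\in E(G)$. $P_n$ is the path with vertices $x_1,\dots,x_n$ and edges $x_ix_{i+1}$. -}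

module Defs where

open import Level using (0ℓ)
open import Data.Nat using (ℕ; suc; _+_)
open import Data.Fin using (Fin; toℕ; splitAt)
open import Data.Fin.Subset using (Subset; _∪_; _─_; ⁅_⁆; ∣_∣)
open import Data.Product using (Σ; ∃; _×_; _,_; proj₁)
open import Data.Sum using (_⊎_; inj₁; inj₂)
open import Data.Empty using (⊥)
open import Relation.Binary.PropositionalEquality using (_≡_)
open import Function.Bundles using (_↔_; _⇔_; Inverse)

record Graph : Set₁ where
  field
    V   : Set
    Adj : V → V → Set
open Graph public

FinGraph : ℕ → Set₁
FinGraph m = Fin m → Fin m → Set

toGraph : ∀ {m} → FinGraph m → Graph
toGraph {m} A = record { V = Fin m ; Adj = A }

PathAdj : (n : ℕ) → FinGraph n
PathAdj n i j = (toℕ j ≡ suc (toℕ i)) ⊎ (toℕ i ≡ suc (toℕ j))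

Path : ℕ → Graph
Path n = toGraph (PathAdj n)

-- Disjoint union of finite graphs, on Fin (m + n) (first m vertices = first copy).
_⊕F_ : ∀ {m n} → FinGraph m → FinGraph n → FinGraph (m + n)
_⊕F_ {m} G H i j with splitAt m i | splitAt m j
... | inj₁ a | inj₁ b = G a b
... | inj₂ a | inj₂ b = H a b
... | inj₁ _ | inj₂ _ = ⊥
... | inj₂ _ | inj₁ _ = ⊥

_⊕_ : Graph → Graph → Graph
G ⊕ H = record { V = V G ⊎ V H ; Adj = adj }
  where
  adj : V G ⊎ V H → V G ⊎ V H → Set
  adj (inj₁ a) (inj₁ b) = Adj G a b
  adj (inj₂ a) (inj₂ b) = Adj H a b
  adj (inj₁ _) (inj₂ _) = ⊥
  adj (inj₂ _) (inj₁ _) = ⊥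

_□_ : Graph → Graph → Graph
G □ H = record
  { V = V G × V H
  ; Adj = λ { (g , h) (g' , h') →
        (g ≡ g' × Adj H h h') ⊎ (h ≡ h' × Adj G g g') }
  }

_△_ : ∀ {n} → Subset n → Subset n → Subset n
A △ B = (A ─ B) ∪ (B ─ A)

Token : (k : ℕ) → ∀ {n} → FinGraph n → Graph
Token k {n} G = record
  { V = Σ (Subset n) (λ A → ∣ A ∣ ≡ k)
  ; Adj = λ A B → Σ (Fin n) λ x → Σ (Fin n) λ y →
      G x y × (proj₁ A △ proj₁ B ≡ ⁅ x ⁆ ∪ ⁅ y ⁆)
  }

_≅_ : Graph → Graph → Set
G ≅ H = Σ (V G ↔ V H) λ f →
  ∀ u v → Adj G u v ⇔ Adj H (Inverse.to f u) (Inverse.to f v)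

-- Each token of a configuration in G ⊕ H lives in one of the two components, and a move
-- slides one token along an edge inside its component.  So a k-configuration is a pair of an
-- i-configuration of G and a j-configuration of H with i + j = k, the split (i , j) never
-- changes along a move, and a move changes exactly one of the two coordinates:
-- Γ_k(G ⊕ H) ≅ ⨁_{i+j=k} Γ_i(G) □ Γ_j(H).  For k = 3 and G = H = P_n the four summands
-- are Γ_3(P_n) □ Γ_0, Γ_2 □ Γ_1, Γ_1 □ Γ_2 and Γ_0 □ Γ_3, where Γ_0 is a single vertex and
-- Γ_1(P_n) ≅ P_n.
module Submission where

open import Defs
open import Data.Nat using (ℕ; zero; suc; _+_; _≤_)
open import Data.Nat.Properties using (≡-irrelevant; suc-injective; +-cancelˡ-≡; +-cancelʳ-≡; 1+n≢n)
open import Data.Bool using (true; false)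
open import Data.Unit using (⊤; tt)
open import Data.Empty using (⊥; ⊥-elim)
open import Data.Fin using (Fin; splitAt; _↑ˡ_; _↑ʳ_) renaming (zero to fzero; suc to fsuc)
open import Data.Fin.Properties using (splitAt-↑ˡ; splitAt-↑ʳ; splitAt⁻¹-↑ˡ; splitAt⁻¹-↑ʳ)
open import Data.Fin.Subset using (Subset; _∪_; _─_; ⁅_⁆; ∣_∣; _∈_) renaming (⊥ to ∅)
open import Data.Fin.Subset.Properties
  using ( ∣⊥∣≡0; ∣⁅x⁆∣≡1; x∈⁅x⁆; x∈⁅y⁆⇒x≡y; x∈p∪q⁺; x∈p∪q⁻; p─q⊆p; ∉⊥
        ; ∪-identityˡ; ∪-identityʳ; ∪-idem)
open import Data.Product using (Σ; ∃; _×_; _,_; proj₁; proj₂)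
open import Data.Product.Algebra using (×-comm)
open import Data.Product.Function.NonDependent.Propositional using (_×-↔_; _×-⇔_)
open import Data.Sum using (_⊎_; inj₁; inj₂; swap) renaming (map to ⊎-map)
open import Data.Sum.Algebra using (⊎-comm; ⊎-assoc)
open import Data.Sum.Function.Propositional using (_⊎-↔_; _⊎-⇔_)
open import Data.Vec using ([]; _∷_; _++_; take; drop; tail)
open import Data.Vec.Properties using (++-injective; take++drop≡id)
open import Relation.Binary.Definitions using (Symmetric; Irreflexive)
open import Relation.Binary.PropositionalEquality
  using (_≡_; _≢_; refl; sym; trans; cong; cong₂; subst; subst₂)
open import Function using (_∘_)
open import Function.Bundles using (_↔_; _⇔_; Inverse; Injection; Equivalence; mk⇔; mk↔ₛ′)
open import Function.Properties.Inverse using (↔-refl; ↔-sym; ↔-trans; ↔⇒⇔; Inverse⇒Injection)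
open import Function.Properties.Equivalence using ()
  renaming (refl to ⇔-refl; sym to ⇔-sym; trans to ⇔-trans)

-- _≅_ unfolds to a Σ-type, from which Agda cannot infer the two graphs; this record can.
record _≃_ (G H : Graph) : Set where
  constructor mk≃
  field
    vertices  : V G ↔ V H
    adjacency : ∀ u v → Adj G u v ⇔ Adj H (Inverse.to vertices u) (Inverse.to vertices v)

≃⇒≅ : ∀ {G H} → G ≃ H → G ≅ H
≃⇒≅ (mk≃ f adj) = f , adj

Adj-cong : ∀ G {u u′ v v′} → u ≡ u′ → v ≡ v′ → Adj G u v ⇔ Adj G u′ v′
Adj-cong _ refl refl = ⇔-refl

≃-refl : ∀ {G} → G ≃ G
≃-refl = mk≃ ↔-refl λ _ _ → ⇔-refl

≃-sym : ∀ {G H} → G ≃ H → H ≃ G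
≃-sym {G} {H} (mk≃ f adj) = mk≃ (↔-sym f) λ u v →
  ⇔-sym (⇔-trans (adj (from u) (from v)) (Adj-cong H (strictlyInverseˡ u) (strictlyInverseˡ v)))
  where open Inverse f

≃-trans : ∀ {G H K} → G ≃ H → H ≃ K → G ≃ K
≃-trans (mk≃ f adjf) (mk≃ g adjg) = mk≃ (↔-trans f g) λ u v → ⇔-trans (adjf u v) (adjg _ _)

≡⇔to≡to : ∀ {A B : Set} (f : A ↔ B) {x y} → x ≡ y ⇔ Inverse.to f x ≡ Inverse.to f y
≡⇔to≡to f = mk⇔ (cong (Inverse.to f)) (Injection.injective (Inverse⇒Injection f))

infixr 4 _⊕-cong_
infixr 5 _□-cong_

_⊕-cong_ : ∀ {G G′ H H′} → G ≃ G′ → H ≃ H′ → (G ⊕ H) ≃ (G′ ⊕ H′)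
_⊕-cong_ {G} {G′} {H} {H′} (mk≃ f adjf) (mk≃ g adjg) = mk≃ (f ⊎-↔ g) adj
  where
  adj : ∀ u v → Adj (G ⊕ H) u v ⇔ Adj (G′ ⊕ H′) (Inverse.to (f ⊎-↔ g) u) (Inverse.to (f ⊎-↔ g) v)
  adj (inj₁ a) (inj₁ b) = adjf a b
  adj (inj₂ a) (inj₂ b) = adjg a b
  adj (inj₁ _) (inj₂ _) = ⇔-refl
  adj (inj₂ _) (inj₁ _) = ⇔-refl

⊕-comm : ∀ {G H} → (G ⊕ H) ≃ (H ⊕ G)
⊕-comm {G} {H} = mk≃ (⊎-comm (V G) (V H)) adj
  where
  adj : ∀ u v → Adj (G ⊕ H) u v ⇔
                Adj (H ⊕ G) (Inverse.to (⊎-comm (V G) (V H)) u) (Inverse.to (⊎-comm (V G) (V H)) v)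
  adj (inj₁ _) (inj₁ _) = ⇔-refl
  adj (inj₂ _) (inj₂ _) = ⇔-refl
  adj (inj₁ _) (inj₂ _) = ⇔-refl
  adj (inj₂ _) (inj₁ _) = ⇔-refl

⊕-assoc : ∀ {G H K} → ((G ⊕ H) ⊕ K) ≃ (G ⊕ (H ⊕ K))
⊕-assoc {G} {H} {K} = mk≃ assoc adj
  where
  assoc : V ((G ⊕ H) ⊕ K) ↔ V (G ⊕ (H ⊕ K))
  assoc = ⊎-assoc _ (V G) (V H) (V K)
  adj : ∀ u v → Adj ((G ⊕ H) ⊕ K) u v ⇔ Adj (G ⊕ (H ⊕ K)) (Inverse.to assoc u) (Inverse.to assoc v)
  adj (inj₁ (inj₁ _)) (inj₁ (inj₁ _)) = ⇔-refl
  adj (inj₁ (inj₁ _)) (inj₁ (inj₂ _)) = ⇔-refl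
  adj (inj₁ (inj₁ _)) (inj₂ _)        = ⇔-refl
  adj (inj₁ (inj₂ _)) (inj₁ (inj₁ _)) = ⇔-refl
  adj (inj₁ (inj₂ _)) (inj₁ (inj₂ _)) = ⇔-refl
  adj (inj₁ (inj₂ _)) (inj₂ _)        = ⇔-refl
  adj (inj₂ _)        (inj₁ (inj₁ _)) = ⇔-refl
  adj (inj₂ _)        (inj₁ (inj₂ _)) = ⇔-refl
  adj (inj₂ _)        (inj₂ _)        = ⇔-refl

⊕-shuffle : ∀ {G₁ G₂ G₃ G₄} → (G₁ ⊕ (G₂ ⊕ (G₃ ⊕ G₄))) ≃ ((G₁ ⊕ G₄) ⊕ (G₂ ⊕ G₃))
⊕-shuffle = ≃-trans (≃-refl ⊕-cong ≃-sym ⊕-assoc) (≃-trans (≃-refl ⊕-cong ⊕-comm) (≃-sym ⊕-assoc))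

_□-cong_ : ∀ {G G′ H H′} → G ≃ G′ → H ≃ H′ → (G □ H) ≃ (G′ □ H′)
mk≃ f adjf □-cong mk≃ g adjg = mk≃ (f ×-↔ g) λ (a , b) (a′ , b′) →
  (≡⇔to≡to f ×-⇔ adjg b b′) ⊎-⇔ (≡⇔to≡to g ×-⇔ adjf a a′)

□-comm : ∀ {G H} → (G □ H) ≃ (H □ G)
□-comm {G} {H} = mk≃ (×-comm (V G) (V H)) λ _ _ → ↔⇒⇔ (⊎-comm _ _)

K₁ : Graph
K₁ = record { V = ⊤ ; Adj = λ _ _ → ⊥ }

□-identityʳ : ∀ {G} → (G □ K₁) ≃ G
□-identityʳ = mk≃ (mk↔ₛ′ proj₁ (_, tt) (λ _ → refl) (λ _ → refl)) λ _ _ →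
  mk⇔ (λ { (inj₁ (_ , ())) ; (inj₂ (_ , a)) → a }) (λ a → inj₂ (refl , a))

△-self : ∀ {n} (p : Subset n) → p △ p ≡ ∅
△-self []          = refl
△-self (true  ∷ p) = cong (false ∷_) (△-self p)
△-self (false ∷ p) = cong (false ∷_) (△-self p)

△≡∅⇒≡ : ∀ {n} (p q : Subset n) → p △ q ≡ ∅ → p ≡ q
△≡∅⇒≡ []          []          _  = refl
△≡∅⇒≡ (true  ∷ p) (true  ∷ q) eq = cong (true ∷_)  (△≡∅⇒≡ p q (cong tail eq))
△≡∅⇒≡ (false ∷ p) (false ∷ q) eq = cong (false ∷_) (△≡∅⇒≡ p q (cong tail eq))
△≡∅⇒≡ (true  ∷ p) (false ∷ q) ()
△≡∅⇒≡ (false ∷ p) (true  ∷ q) ()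

△≡∅⇔≡ : ∀ {n} {p q : Subset n} → p △ q ≡ ∅ ⇔ p ≡ q
△≡∅⇔≡ {p = p} {q} = mk⇔ (△≡∅⇒≡ p q) λ { refl → △-self p }

∅△p≡p : ∀ {n} (p : Subset n) → ∅ △ p ≡ p
∅△p≡p []          = refl
∅△p≡p (true  ∷ p) = cong (true ∷_)  (∅△p≡p p)
∅△p≡p (false ∷ p) = cong (false ∷_) (∅△p≡p p)

p△∅≡p : ∀ {n} (p : Subset n) → p △ ∅ ≡ p
p△∅≡p []          = refl
p△∅≡p (true  ∷ p) = cong (true ∷_)  (p△∅≡p p)
p△∅≡p (false ∷ p) = cong (false ∷_) (p△∅≡p p)

x∈p△q⇒x∈p⊎x∈q : ∀ {n} {x : Fin n} (p q : Subset n) → x ∈ p △ q → x ∈ p ⊎ x ∈ q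
x∈p△q⇒x∈p⊎x∈q p q = ⊎-map (p─q⊆p p q) (p─q⊆p q p) ∘ x∈p∪q⁻ (p ─ q) (q ─ p)

⁅x⁆△⁅y⁆≡⁅x⁆∪⁅y⁆ : ∀ {n} {x y : Fin n} → x ≢ y → ⁅ x ⁆ △ ⁅ y ⁆ ≡ ⁅ x ⁆ ∪ ⁅ y ⁆
⁅x⁆△⁅y⁆≡⁅x⁆∪⁅y⁆ {x = fzero}  {fzero}  x≢y = ⊥-elim (x≢y refl)
⁅x⁆△⁅y⁆≡⁅x⁆∪⁅y⁆ {x = fzero}  {fsuc y} _   =
  cong (true ∷_) (trans (∅△p≡p ⁅ y ⁆) (sym (∪-identityˡ ⁅ y ⁆)))
⁅x⁆△⁅y⁆≡⁅x⁆∪⁅y⁆ {x = fsuc x} {fzero}  _   =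
  cong (true ∷_) (trans (p△∅≡p ⁅ x ⁆) (sym (∪-identityʳ ⁅ x ⁆)))
⁅x⁆△⁅y⁆≡⁅x⁆∪⁅y⁆ {x = fsuc x} {fsuc y} x≢y =
  cong (false ∷_) (⁅x⁆△⁅y⁆≡⁅x⁆∪⁅y⁆ (x≢y ∘ cong fsuc))

∣p∣≡0⇒p≡∅ : ∀ {n} (p : Subset n) → ∣ p ∣ ≡ 0 → p ≡ ∅
∣p∣≡0⇒p≡∅ []          _  = refl
∣p∣≡0⇒p≡∅ (false ∷ p) eq = cong (false ∷_) (∣p∣≡0⇒p≡∅ p eq)
∣p∣≡0⇒p≡∅ (true  ∷ p) ()

∣p∣≡1⇒p≡⁅x⁆ : ∀ {n} (p : Subset n) → ∣ p ∣ ≡ 1 → ∃ λ x → p ≡ ⁅ x ⁆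
∣p∣≡1⇒p≡⁅x⁆ (true  ∷ p) eq = fzero , cong (true ∷_) (∣p∣≡0⇒p≡∅ p (suc-injective eq))
∣p∣≡1⇒p≡⁅x⁆ (false ∷ p) eq with ∣p∣≡1⇒p≡⁅x⁆ p eq
... | x , p≡⁅x⁆ = fsuc x , cong (false ∷_) p≡⁅x⁆

⁅⁆-injective : ∀ {n} {x y : Fin n} → ⁅ x ⁆ ≡ ⁅ y ⁆ → x ≡ y
⁅⁆-injective {x = x} {y} eq = x∈⁅y⁆⇒x≡y y (subst (x ∈_) eq (x∈⁅x⁆ x))

∣p++q∣ : ∀ {m n} (p : Subset m) (q : Subset n) → ∣ p ++ q ∣ ≡ ∣ p ∣ + ∣ q ∣
∣p++q∣ []          q = refl
∣p++q∣ (true  ∷ p) q = cong suc (∣p++q∣ p q)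
∣p++q∣ (false ∷ p) q = ∣p++q∣ p q

∣take∣+∣drop∣ : ∀ m {n} (r : Subset (m + n)) → ∣ take m r ∣ + ∣ drop m r ∣ ≡ ∣ r ∣
∣take∣+∣drop∣ m {n} r =
  trans (sym (∣p++q∣ (take m r) (drop m r))) (cong (∣_∣ {n = m + n}) (take++drop≡id m r))

++-△-++ : ∀ {m n} (p p′ : Subset m) (q q′ : Subset n) → (p ++ q) △ (p′ ++ q′) ≡ (p △ p′) ++ (q △ q′)
++-△-++ []      []       q q′ = refl
++-△-++ (_ ∷ p) (_ ∷ p′) q q′ = cong (_ ∷_) (++-△-++ p p′ q q′)

++-∪-++ : ∀ {m n} (p p′ : Subset m) (q q′ : Subset n) → (p ++ q) ∪ (p′ ++ q′) ≡ (p ∪ p′) ++ (q ∪ q′)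
++-∪-++ []      []       q q′ = refl
++-∪-++ (_ ∷ p) (_ ∷ p′) q q′ = cong (_ ∷_) (++-∪-++ p p′ q q′)

△-++-≡⇔ : ∀ {m n} {p p′ s : Subset m} {q q′ t : Subset n} →
          (p ++ q) △ (p′ ++ q′) ≡ s ++ t ⇔ (p △ p′ ≡ s × q △ q′ ≡ t)
△-++-≡⇔ {p = p} {p′} {s} {q} {q′} = mk⇔
  (λ eq → ++-injective (p △ p′) s (trans (sym (++-△-++ p p′ q q′)) eq))
  (λ (eqˡ , eqʳ) → trans (++-△-++ p p′ q q′) (cong₂ _++_ eqˡ eqʳ))

∅++∅ : ∀ m n → ∅ {n = m} ++ ∅ {n = n} ≡ ∅
∅++∅ zero    n = refl
∅++∅ (suc m) n = cong (false ∷_) (∅++∅ m n)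

⁅↑ˡ⁆ : ∀ {m} n (x : Fin m) → ⁅ x ↑ˡ n ⁆ ≡ ⁅ x ⁆ ++ ∅
⁅↑ˡ⁆ {suc m} n fzero    = cong (true ∷_) (sym (∅++∅ m n))
⁅↑ˡ⁆         n (fsuc x) = cong (false ∷_) (⁅↑ˡ⁆ n x)

⁅↑ʳ⁆ : ∀ m {n} (x : Fin n) → ⁅ m ↑ʳ x ⁆ ≡ ∅ ++ ⁅ x ⁆
⁅↑ʳ⁆ zero    x = refl
⁅↑ʳ⁆ (suc m) x = cong (false ∷_) (⁅↑ʳ⁆ m x)

⁅↑ˡ⁆∪⁅↑ˡ⁆ : ∀ {m} n (x y : Fin m) → ⁅ x ↑ˡ n ⁆ ∪ ⁅ y ↑ˡ n ⁆ ≡ (⁅ x ⁆ ∪ ⁅ y ⁆) ++ ∅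
⁅↑ˡ⁆∪⁅↑ˡ⁆ n x y = trans (cong₂ _∪_ (⁅↑ˡ⁆ n x) (⁅↑ˡ⁆ n y))
  (trans (++-∪-++ ⁅ x ⁆ ⁅ y ⁆ ∅ ∅) (cong ((⁅ x ⁆ ∪ ⁅ y ⁆) ++_) (∪-idem ∅)))

⁅↑ʳ⁆∪⁅↑ʳ⁆ : ∀ m {n} (x y : Fin n) → ⁅ m ↑ʳ x ⁆ ∪ ⁅ m ↑ʳ y ⁆ ≡ ∅ ++ (⁅ x ⁆ ∪ ⁅ y ⁆)
⁅↑ʳ⁆∪⁅↑ʳ⁆ m x y = trans (cong₂ _∪_ (⁅↑ʳ⁆ m x) (⁅↑ʳ⁆ m y))
  (trans (++-∪-++ ∅ ∅ ⁅ x ⁆ ⁅ y ⁆) (cong (_++ (⁅ x ⁆ ∪ ⁅ y ⁆)) (∪-idem ∅)))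

Σ-≡⇔ : ∀ {A : Set} {f : A → ℕ} {k} {a b : A} {fa≡k : f a ≡ k} {fb≡k : f b ≡ k} →
       (a , fa≡k) ≡ (b , fb≡k) ⇔ a ≡ b
Σ-≡⇔ {a = a} = mk⇔ (cong proj₁) λ { refl → cong (a ,_) (≡-irrelevant _ _) }

TokenAdj : ∀ {n} → FinGraph n → Subset n → Subset n → Set
TokenAdj {n} G p q = Σ (Fin n) λ x → Σ (Fin n) λ y → G x y × p △ q ≡ ⁅ x ⁆ ∪ ⁅ y ⁆

TokenAdj⇒≢ : ∀ {n} {G : FinGraph n} {p q} → TokenAdj G p q → p ≢ q
TokenAdj⇒≢ {p = p} (x , _ , _ , eq) refl =
  ∉⊥ (subst (x ∈_) (trans (sym eq) (△-self p)) (x∈p∪q⁺ (inj₁ (x∈⁅x⁆ x))))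

Token₀≃K₁ : ∀ {n} {G : FinGraph n} → Token 0 G ≃ K₁
Token₀≃K₁ {n} = mk≃ (mk↔ₛ′ _ (λ _ → ∅ , ∣⊥∣≡0 n) (λ _ → refl) empty) λ (p , ∣p∣≡0) (q , ∣q∣≡0) →
  mk⇔ (λ adj → TokenAdj⇒≢ adj (trans (∣p∣≡0⇒p≡∅ p ∣p∣≡0) (sym (∣p∣≡0⇒p≡∅ q ∣q∣≡0)))) λ ()
  where
  empty : ∀ v → (∅ , ∣⊥∣≡0 n) ≡ v
  empty (p , ∣p∣≡0) = Equivalence.from Σ-≡⇔ (sym (∣p∣≡0⇒p≡∅ p ∣p∣≡0))

□-Token₀ : ∀ {G n} {H : FinGraph n} → (G □ Token 0 H) ≃ G
□-Token₀ = ≃-trans (≃-refl □-cong Token₀≃K₁) □-identityʳ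

module _ {n} {G : FinGraph n} (sym-G : Symmetric G) (irrefl-G : Irreflexive _≡_ G) where

  G⇔TokenAdj⁅⁆⁅⁆ : ∀ {x y} → G x y ⇔ TokenAdj G ⁅ x ⁆ ⁅ y ⁆
  G⇔TokenAdj⁅⁆⁅⁆ {x} {y} = mk⇔ (λ g → x , y , g , ⁅x⁆△⁅y⁆≡⁅x⁆∪⁅y⁆ λ x≡y → irrefl-G x≡y g) from
    where
    endpoint : ∀ {z} → z ∈ ⁅ x ⁆ △ ⁅ y ⁆ → z ≡ x ⊎ z ≡ y
    endpoint = ⊎-map (x∈⁅y⁆⇒x≡y x) (x∈⁅y⁆⇒x≡y y) ∘ x∈p△q⇒x∈p⊎x∈q ⁅ x ⁆ ⁅ y ⁆
    from : TokenAdj G ⁅ x ⁆ ⁅ y ⁆ → G x y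
    from (a , b , g , eq) with endpoint (subst (a ∈_) (sym eq) (x∈p∪q⁺ (inj₁ (x∈⁅x⁆ a))))
                             | endpoint (subst (b ∈_) (sym eq) (x∈p∪q⁺ (inj₂ (x∈⁅x⁆ b))))
    ... | inj₁ refl | inj₂ refl = g
    ... | inj₂ refl | inj₁ refl = sym-G g
    ... | inj₁ refl | inj₁ refl = ⊥-elim (irrefl-G refl g)
    ... | inj₂ refl | inj₂ refl = ⊥-elim (irrefl-G refl g)

  Token₁≃toGraph : Token 1 G ≃ toGraph G
  Token₁≃toGraph = ≃-sym (mk≃ (mk↔ₛ′ singleton element singleton-element element-singleton)
                              λ _ _ → G⇔TokenAdj⁅⁆⁅⁆)
    where
    singleton : Fin n → V (Token 1 G)
    singleton x = ⁅ x ⁆ , ∣⁅x⁆∣≡1 x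
    element : V (Token 1 G) → Fin n
    element (p , ∣p∣≡1) = proj₁ (∣p∣≡1⇒p≡⁅x⁆ p ∣p∣≡1)
    singleton-element : ∀ v → singleton (element v) ≡ v
    singleton-element (p , ∣p∣≡1) = Equivalence.from Σ-≡⇔ (sym (proj₂ (∣p∣≡1⇒p≡⁅x⁆ p ∣p∣≡1)))
    element-singleton : ∀ x → element (singleton x) ≡ x
    element-singleton x = ⁅⁆-injective (sym (proj₂ (∣p∣≡1⇒p≡⁅x⁆ ⁅ x ⁆ (∣⁅x⁆∣≡1 x))))

data ⊕F-Edge {m n} (G : FinGraph m) (H : FinGraph n) : Fin (m + n) → Fin (m + n) → Set where
  left  : ∀ {x y} → G x y → ⊕F-Edge G H (x ↑ˡ n) (y ↑ˡ n)
  right : ∀ {x y} → H x y → ⊕F-Edge G H (m ↑ʳ x) (m ↑ʳ y)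

module _ {m n} {G : FinGraph m} {H : FinGraph n} where

  ⊕F⇒Edge : ∀ {x y} → (G ⊕F H) x y → ⊕F-Edge G H x y
  ⊕F⇒Edge {x} {y} e with splitAt m x in eqx | splitAt m y in eqy
  ... | inj₁ _ | inj₁ _ = subst₂ (⊕F-Edge G H) (splitAt⁻¹-↑ˡ eqx) (splitAt⁻¹-↑ˡ eqy) (left e)
  ... | inj₂ _ | inj₂ _ = subst₂ (⊕F-Edge G H) (splitAt⁻¹-↑ʳ eqx) (splitAt⁻¹-↑ʳ eqy) (right e)

  Edge⇒⊕F : ∀ {x y} → ⊕F-Edge G H x y → (G ⊕F H) x y
  Edge⇒⊕F (left  {x} {y} e) rewrite splitAt-↑ˡ m x n | splitAt-↑ˡ m y n = e
  Edge⇒⊕F (right {x} {y} e) rewrite splitAt-↑ʳ m n x | splitAt-↑ʳ m n y = e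

  moves-left : ∀ {p p′ : Subset m} {q q′ : Subset n} {x y} →
    (p ++ q) △ (p′ ++ q′) ≡ ⁅ x ↑ˡ n ⁆ ∪ ⁅ y ↑ˡ n ⁆ ⇔ (p △ p′ ≡ ⁅ x ⁆ ∪ ⁅ y ⁆ × q ≡ q′)
  moves-left {x = x} {y} rewrite ⁅↑ˡ⁆∪⁅↑ˡ⁆ n x y = ⇔-trans △-++-≡⇔ (⇔-refl ×-⇔ △≡∅⇔≡)

  moves-right : ∀ {p p′ : Subset m} {q q′ : Subset n} {x y} →
    (p ++ q) △ (p′ ++ q′) ≡ ⁅ m ↑ʳ x ⁆ ∪ ⁅ m ↑ʳ y ⁆ ⇔ (p ≡ p′ × q △ q′ ≡ ⁅ x ⁆ ∪ ⁅ y ⁆)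
  moves-right {x = x} {y} rewrite ⁅↑ʳ⁆∪⁅↑ʳ⁆ m x y = ⇔-trans △-++-≡⇔ (△≡∅⇔≡ ×-⇔ ⇔-refl)

  TokenAdj-⊕F : ∀ {p p′ : Subset m} {q q′ : Subset n} →
    TokenAdj (G ⊕F H) (p ++ q) (p′ ++ q′) ⇔
    ((p ≡ p′ × TokenAdj H q q′) ⊎ (q ≡ q′ × TokenAdj G p p′))
  TokenAdj-⊕F = mk⇔ to from
    where
    to : ∀ {p p′ q q′} → TokenAdj (G ⊕F H) (p ++ q) (p′ ++ q′) →
         (p ≡ p′ × TokenAdj H q q′) ⊎ (q ≡ q′ × TokenAdj G p p′)
    to (_ , _ , e , eq) with ⊕F⇒Edge e
    ... | left {x} {y} g with Equivalence.to moves-left eq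
    ...   | eqᴳ , q≡q′ = inj₂ (q≡q′ , x , y , g , eqᴳ)
    to (_ , _ , e , eq) | right {x} {y} h with Equivalence.to moves-right eq
    ...   | p≡p′ , eqᴴ = inj₁ (p≡p′ , x , y , h , eqᴴ)
    from : ∀ {p p′ q q′} → (p ≡ p′ × TokenAdj H q q′) ⊎ (q ≡ q′ × TokenAdj G p p′) →
           TokenAdj (G ⊕F H) (p ++ q) (p′ ++ q′)
    from (inj₁ (p≡p′ , x , y , h , eqᴴ)) =
      m ↑ʳ x , m ↑ʳ y , Edge⇒⊕F (right h) , Equivalence.from moves-right (p≡p′ , eqᴴ)
    from (inj₂ (q≡q′ , x , y , g , eqᴳ)) =
      x ↑ˡ n , y ↑ˡ n , Edge⇒⊕F (left g) , Equivalence.from moves-left (eqᴳ , q≡q′)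

TokenPair : ∀ {m n} → ℕ → FinGraph m → FinGraph n → Graph
TokenPair {m} {n} k G H = record
  { V   = Σ (Subset m × Subset n) λ (p , q) → ∣ p ∣ + ∣ q ∣ ≡ k
  ; Adj = λ ((p , q) , _) ((p′ , q′) , _) → (p ≡ p′ × TokenAdj H q q′) ⊎ (q ≡ q′ × TokenAdj G p p′)
  }

TokenPair≃Token-⊕F : ∀ {m n} k (G : FinGraph m) (H : FinGraph n) →
  TokenPair k G H ≃ Token k (G ⊕F H)
TokenPair≃Token-⊕F {m} k G H =
  mk≃ (mk↔ₛ′ concat split concat-split split-concat) λ _ _ → ⇔-sym TokenAdj-⊕F
  where
  concat : V (TokenPair k G H) → V (Token k (G ⊕F H))
  concat ((p , q) , eq) = p ++ q , trans (∣p++q∣ p q) eq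
  split : V (Token k (G ⊕F H)) → V (TokenPair k G H)
  split (r , eq) = (take m r , drop m r) , trans (∣take∣+∣drop∣ m r) eq
  concat-split : ∀ v → concat (split v) ≡ v
  concat-split (r , _) = Equivalence.from Σ-≡⇔ (take++drop≡id m r)
  split-concat : ∀ v → split (concat v) ≡ v
  split-concat ((p , q) , _) with ++-injective (take m (p ++ q)) p (take++drop≡id m (p ++ q))
  ... | take≡p , drop≡q = Equivalence.from Σ-≡⇔ (cong₂ _,_ take≡p drop≡q)

-- Convolution A B k is ⨁_{i + j ≡ k} A i □ B j, listed by increasing i.
Convolution : (ℕ → Graph) → (ℕ → Graph) → ℕ → Graph
Convolution A B zero    = A 0 □ B 0
Convolution A B (suc k) = (A 0 □ B (suc k)) ⊕ Convolution (A ∘ suc) B k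

Summands : (ℕ → Graph) → (ℕ → Graph) → ℕ → Set
Summands A B k = Σ ℕ λ i → Σ ℕ λ j → i + j ≡ k × V (A i) × V (B j)

inject : ∀ {A B : ℕ → Graph} {k} i j → i + j ≡ k → V (A i) → V (B j) → V (Convolution A B k)
inject {B = B} {zero}      zero    j eq a b = a , subst (V ∘ B) eq b
inject {B = B} {suc k}     zero    j eq a b = inj₁ (a , subst (V ∘ B) eq b)
inject {A = A} {k = suc k} (suc i) j eq a b = inj₂ (inject {A = A ∘ suc} i j (suc-injective eq) a b)

shift : ∀ {A B k} → Summands (A ∘ suc) B k → Summands A B (suc k)
shift (i , j , eq , a , b) = suc i , j , cong suc eq , a , b

decompose : ∀ {A B} k → V (Convolution A B k) → Summands A B k
decompose         zero    (a , b)        = 0 , 0 , refl , a , b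
decompose         (suc k) (inj₁ (a , b)) = 0 , suc k , refl , a , b
decompose {A} {B} (suc k) (inj₂ v)       = shift {A} {B} (decompose k v)

decompose-inject : ∀ {A B k} i j (eq : i + j ≡ k) a b →
  decompose {A} {B} k (inject i j eq a b) ≡ (i , j , eq , a , b)
decompose-inject {k = zero}      zero    j refl a b = refl
decompose-inject {k = suc k}     zero    j refl a b = refl
decompose-inject {A} {B} {suc k} (suc i) j refl a b =
  cong (shift {A} {B}) (decompose-inject {A ∘ suc} {B} i j refl a b)

inject-decompose : ∀ {A B} k v →
  let (i , j , eq , a , b) = decompose {A} {B} k v in inject {A} {B} i j eq a b ≡ v
inject-decompose         zero    (a , b)        = refl
inject-decompose         (suc k) (inj₁ (a , b)) = refl
inject-decompose {A} {B} (suc k) (inj₂ v)       =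
  trans (inject-shift (decompose k v)) (cong inj₂ (inject-decompose k v))
  where
  inject-shift : (s : Summands (A ∘ suc) B k) → let (i , j , eq , a , b) = s in
    inject {A} {B} (suc i) j (cong suc eq) a b ≡ inj₂ (inject i j eq a b)
  inject-shift (i , j , refl , a , b) = refl

Convolution-↔ : ∀ {A B k} → V (Convolution A B k) ↔ Summands A B k
Convolution-↔ {A} {B} {k} = mk↔ₛ′ (decompose k) (λ (i , j , eq , a , b) → inject {A} {B} i j eq a b)
  (λ (i , j , eq , a , b) → decompose-inject i j eq a b) (inject-decompose k)

inject-adj : ∀ {A B k} i j (eq : i + j ≡ k) a b a′ b′ →
  Adj (Convolution A B k) (inject i j eq a b) (inject i j eq a′ b′) ⇔
  Adj (A i □ B j) (a , b) (a′ , b′)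
inject-adj {k = zero}      zero    j refl _ _ _ _ = ⇔-refl
inject-adj {k = suc k}     zero    j refl _ _ _ _ = ⇔-refl
inject-adj {A} {k = suc k} (suc i) j eq   _ _ _ _ =
  inject-adj {A ∘ suc} i j (suc-injective eq) _ _ _ _

inject-adj-index : ∀ {A B k} i j i′ j′ (eq : i + j ≡ k) (eq′ : i′ + j′ ≡ k) a b a′ b′ →
  Adj (Convolution A B k) (inject i j eq a b) (inject i′ j′ eq′ a′ b′) → i ≡ i′
inject-adj-index {k = zero}  zero    _ zero     _ _ _ _ _ _ _ _  = refl
inject-adj-index {k = suc k} zero    _ zero     _ _ _ _ _ _ _ _  = refl
inject-adj-index {k = suc k} zero    _ (suc i′) _ _ _ _ _ _ _ ()
inject-adj-index {k = suc k} (suc i) _ zero     _ _ _ _ _ _ _ ()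
inject-adj-index {A} {k = suc k} (suc i) j (suc i′) j′ eq eq′ a b a′ b′ adj =
  cong suc (inject-adj-index {A ∘ suc} i j i′ j′ (suc-injective eq) (suc-injective eq′) _ _ _ _ adj)

Tokens : ∀ {n} → FinGraph n → ℕ → Graph
Tokens G k = Token k G

module _ {m n} (k : ℕ) (G : FinGraph m) (H : FinGraph n) where

  TokenPair-↔ : V (TokenPair k G H) ↔ Summands (Tokens G) (Tokens H) k
  TokenPair-↔ = mk↔ₛ′ sizes forget (λ { (_ , _ , _ , (_ , refl) , (_ , refl)) → refl }) (λ _ → refl)
    where
    sizes : V (TokenPair k G H) → Summands (Tokens G) (Tokens H) k
    sizes ((p , q) , eq) = ∣ p ∣ , ∣ q ∣ , eq , (p , refl) , (q , refl)
    forget : Summands (Tokens G) (Tokens H) k → V (TokenPair k G H)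
    forget (_ , _ , eq , (p , ∣p∣≡i) , (q , ∣q∣≡j)) = (p , q) , trans (cong₂ _+_ ∣p∣≡i ∣q∣≡j) eq

  embed : V (TokenPair k G H) → V (Convolution (Tokens G) (Tokens H) k)
  embed ((p , q) , eq) = inject (∣ p ∣) (∣ q ∣) eq (p , refl) (q , refl)

  embed-reindex : ∀ {p q i j} (∣p∣≡i : ∣ p ∣ ≡ i) (∣q∣≡j : ∣ q ∣ ≡ j) (eq : i + j ≡ k) eq′ →
    embed ((p , q) , eq′) ≡ inject i j eq (p , ∣p∣≡i) (q , ∣q∣≡j)
  embed-reindex {p} {q} refl refl eq eq′ =
    cong (λ eq → inject (∣ p ∣) (∣ q ∣) eq (p , refl) (q , refl)) (≡-irrelevant eq′ eq)

  TokenPair-adj-size : ∀ {p q p′ q′} (eq : ∣ p ∣ + ∣ q ∣ ≡ k) (eq′ : ∣ p′ ∣ + ∣ q′ ∣ ≡ k) →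
    Adj (TokenPair k G H) ((p , q) , eq) ((p′ , q′) , eq′) → ∣ p′ ∣ ≡ ∣ p ∣
  TokenPair-adj-size              eq eq′ (inj₁ (refl , _)) = refl
  TokenPair-adj-size {p} {q} {p′} eq eq′ (inj₂ (refl , _)) =
    +-cancelʳ-≡ (∣ q ∣) (∣ p′ ∣) (∣ p ∣) (trans eq′ (sym eq))

  TokenPair≃Convolution : TokenPair k G H ≃ Convolution (Tokens G) (Tokens H) k
  TokenPair≃Convolution = mk≃ (↔-trans TokenPair-↔ (↔-sym Convolution-↔)) adj
    where
    C : Graph
    C = Convolution (Tokens G) (Tokens H) k
    adj : ∀ u v → Adj (TokenPair k G H) u v ⇔ Adj C (embed u) (embed v)
    adj u@((p , q) , eq) v@((p′ , q′) , eq′) = mk⇔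
      (λ a → Equivalence.to (same-split (TokenPair-adj-size eq eq′ a)) a)
      (λ c → Equivalence.from (same-split (sym (inject-adj-index _ _ _ _ eq eq′ _ _ _ _ c))) c)
      where
      -- Either kind of adjacency forces equal splits, so both vertices live in the summand of u.
      same-split : ∣ p′ ∣ ≡ ∣ p ∣ → Adj (TokenPair k G H) u v ⇔ Adj C (embed u) (embed v)
      same-split ∣p′∣≡∣p∣ = ⇔-trans forget-sizes
        (⇔-sym (⇔-trans (Adj-cong C refl v-reindexed) (inject-adj (∣ p ∣) (∣ q ∣) eq _ _ _ _)))
        where
        ∣q′∣≡∣q∣ : ∣ q′ ∣ ≡ ∣ q ∣
        ∣q′∣≡∣q∣ = +-cancelˡ-≡ (∣ p ∣) (∣ q′ ∣) (∣ q ∣)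
          (trans (cong (_+ ∣ q′ ∣) (sym ∣p′∣≡∣p∣)) (trans eq′ (sym eq)))
        v-reindexed : embed v ≡ inject (∣ p ∣) (∣ q ∣) eq (p′ , ∣p′∣≡∣p∣) (q′ , ∣q′∣≡∣q∣)
        v-reindexed = embed-reindex ∣p′∣≡∣p∣ ∣q′∣≡∣q∣ eq eq′
        forget-sizes : Adj (TokenPair k G H) u v ⇔
          Adj (Token (∣ p ∣) G □ Token (∣ q ∣) H)
              ((p , refl) , (q , refl)) ((p′ , ∣p′∣≡∣p∣) , (q′ , ∣q′∣≡∣q∣))
        forget-sizes = (⇔-sym Σ-≡⇔ ×-⇔ ⇔-refl) ⊎-⇔ (⇔-sym Σ-≡⇔ ×-⇔ ⇔-refl)

Token-⊕F≃Convolution : ∀ {m n} k (G : FinGraph m) (H : FinGraph n) →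
  Token k (G ⊕F H) ≃ Convolution (Tokens G) (Tokens H) k
Token-⊕F≃Convolution k G H =
  ≃-trans (≃-sym (TokenPair≃Token-⊕F k G H)) (TokenPair≃Convolution k G H)

PathAdj-symmetric : ∀ {n} → Symmetric (PathAdj n)
PathAdj-symmetric = swap

PathAdj-irreflexive : ∀ {n} → Irreflexive _≡_ (PathAdj n)
PathAdj-irreflexive refl (inj₁ eq) = 1+n≢n (sym eq)
PathAdj-irreflexive refl (inj₂ eq) = 1+n≢n (sym eq)

lemma1 : (n : ℕ) → 3 ≤ n →
    Token 3 (PathAdj n ⊕F PathAdj n)
      ≅ ((Token 3 (PathAdj n) ⊕ Token 3 (PathAdj n))
          ⊕ ((Token 2 (PathAdj n) □ Path n) ⊕ (Token 2 (PathAdj n) □ Path n)))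
lemma1 n _ = ≃⇒≅ (≃-trans (Token-⊕F≃Convolution 3 P P) (≃-trans summands ⊕-shuffle))
  where
  P : FinGraph n
  P = PathAdj n
  T₁≃P : Token 1 P ≃ Path n
  T₁≃P = Token₁≃toGraph PathAdj-symmetric PathAdj-irreflexive
  summands : Convolution (Tokens P) (Tokens P) 3 ≃
             (Token 3 P ⊕ ((Token 2 P □ Path n) ⊕ ((Token 2 P □ Path n) ⊕ Token 3 P)))
  summands = ≃-trans □-comm □-Token₀
     ⊕-cong ≃-trans □-comm (≃-refl □-cong T₁≃P)
     ⊕-cong ≃-refl □-cong T₁≃P
     ⊕-cong □-Token₀
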